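{- An infinite set $A\subseteq\omega$ is majorreducible if and only if it is both majorenumerable and introreducible.
   Context: $p_A$ is the principal function of $A$ ($p_A(n)$ is the $n$-th element of $A$ in increasing order). An enumeration operator $\Theta$ is a c.e. set of pairs $\langle u,n\rangle$, with $\Theta(X)=\{n:\exists u\,(D_u\subseteq X\wedge\langle u,n\rangle\in\Theta)\}$; $A\le_e X$ if $A=\Theta(X)$ for some enumeration operator. $A$ is majorreducible if every function $f$ with $f(n)\ge p_A(n)$ for all $n$ computes $A$ (oracle the graph of $f$); majorenumerable if $A\le_e\mathrm{graph}(f)$ for every such $f$; introreducible if $A\le_T C$ for every infinite $C\subseteq A$. -}

module Defs where

open import Data.Nat using (ℕ; zero; suc; _+_; _≤_; _<_; ⌊_/2⌋; _%_; _≡ᵇ_)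
open import Data.Bool using (Bool; true; false; if_then_else_; _∧_)
open import Data.Fin using (Fin)
open import Data.Vec using (Vec; []; _∷_)
open import Data.List using (upTo)
open import Data.Bool.ListAction using (any)
open import Data.Product using (Σ; ∃; _×_)
open import Function.Bundles using (_⇔_)
open import Relation.Binary.PropositionalEquality using (_≡_)

SetN : Set
SetN = ℕ → Bool

Infinite : SetN → Set
Infinite A = ∀ n → ∃ λ m → n ≤ m × A m ≡ true

_⊆_ : SetN → SetN → Set
C ⊆ A = ∀ m → C m ≡ true → A m ≡ true

IsPrincipal : SetN → (ℕ → ℕ) → Set
IsPrincipal A p = (∀ n → p n < p (suc n)) × (∀ m → (A m ≡ true) ⇔ (∃ λ n → p n ≡ m))

Majorizes : (ℕ → ℕ) → (ℕ → ℕ) → Set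
Majorizes f p = ∀ n → p n ≤ f n

-- Cantor pairing ⟨x , y⟩ = (x+y)(x+y+1)/2 + y

tri : ℕ → ℕ
tri zero = zero
tri (suc n) = suc n + tri n

pair : ℕ → ℕ → ℕ
pair x y = tri (x + y) + y

-- graph of f, as a set of codes ⟨x , f x⟩ (⟨x,y⟩ ≥ x, y, so bounded search suffices)
graph : (ℕ → ℕ) → SetN
graph f k = any (λ x → any (λ y → (pair x y ≡ᵇ k) ∧ (f x ≡ᵇ y)) (upTo (suc k))) (upTo (suc k))

-- Canonical finite sets: m ∈ D_u iff bit m of the binary expansion of u is 1.

bit : ℕ → ℕ → Bool
bit u zero = (u % 2) ≡ᵇ 1
bit u (suc m) = bit ⌊ u /2⌋ m

D_⊆_ : ℕ → SetN → Set
D u ⊆ X = ∀ m → bit u m ≡ true → X m ≡ true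

-- Oracle partial recursive functions (μ-recursive with an oracle query).

data Prog : ℕ → Set where
  zer  : ∀ {k} → Prog k
  succ : Prog 1
  proj : ∀ {k} → Fin k → Prog k
  orc  : Prog 1
  comp : ∀ {k m} → Prog m → Vec (Prog k) m → Prog k
  prec : ∀ {k} → Prog k → Prog (suc (suc k)) → Prog (suc k)
  mu   : ∀ {k} → Prog (suc k) → Prog k

data Eval (X : SetN) : ∀ {k} → Prog k → Vec ℕ k → ℕ → Set
data EvalVec (X : SetN) {k : ℕ} : ∀ {m} → Vec (Prog k) m → Vec ℕ k → Vec ℕ m → Set

data Eval X where
  e-zer  : ∀ {k} {xs : Vec ℕ k} → Eval X zer xs 0
  e-succ : ∀ {n} → Eval X succ (n ∷ []) (suc n)
  e-proj : ∀ {k} (i : Fin k) {xs : Vec ℕ k} → Eval X (proj i) xs (Data.Vec.lookup xs i)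
  e-orc  : ∀ {n} → Eval X orc (n ∷ []) (if X n then 1 else 0)
  e-comp : ∀ {k m} {g : Prog m} {hs : Vec (Prog k) m} {xs ys y} →
           EvalVec X hs xs ys → Eval X g ys y → Eval X (comp g hs) xs y
  e-prec0 : ∀ {k} {g : Prog k} {s} {xs y} →
            Eval X g xs y → Eval X (prec g s) (0 ∷ xs) y
  e-precS : ∀ {k} {g : Prog k} {s} {n xs y z} →
            Eval X (prec g s) (n ∷ xs) y → Eval X s (n ∷ y ∷ xs) z →
            Eval X (prec g s) (suc n ∷ xs) z
  e-mu   : ∀ {k} {f : Prog (suc k)} {xs n} →
           Eval X f (n ∷ xs) 0 →
           (∀ i → i < n → ∃ λ v → Eval X f (i ∷ xs) (suc v)) →
           Eval X (mu f) xs n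

data EvalVec X where
  ev-[] : ∀ {xs} → EvalVec X [] xs []
  ev-∷  : ∀ {m} {h} {hs : Vec (Prog _) m} {xs y ys} →
          Eval X h xs y → EvalVec X hs xs ys → EvalVec X (h ∷ hs) xs (y ∷ ys)

∅ : SetN
∅ _ = false

_≤T_ : SetN → SetN → Set
A ≤T X = ∃ λ (e : Prog 1) → ∀ n → Eval X e (n ∷ []) (if A n then 1 else 0)


-- x ∈ W_e : the c.e. set which is the domain of the (oracle-free) program e.
InW : Prog 1 → ℕ → Set
InW e x = ∃ λ y → Eval ∅ e (x ∷ []) y

-- A ≤_e X : A = Θ(X) for the enumeration operator Θ = W_e (a c.e. set of codes ⟨u , n⟩).
_≤e_ : SetN → SetN → Set
A ≤e X = ∃ λ (e : Prog 1) → ∀ n →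
  (A n ≡ true) ⇔ (∃ λ u → (D u ⊆ X) × InW e (pair u n))

Majorreducible : SetN → Set
Majorreducible A = ∀ p → IsPrincipal A p → ∀ f → Majorizes f p → A ≤T graph f

Majorenumerable : SetN → Set
Majorenumerable A = ∀ p → IsPrincipal A p → ∀ f → Majorizes f p → A ≤e graph f

Introreducible : SetN → Set
Introreducible A = ∀ C → Infinite C → C ⊆ A → A ≤T C

-- (⇒) A Turing reduction of A to graph f consults only finitely many points of the
-- graph, so running it against every finite set D u ⊆ graph f yields an enumeration
-- operator: A ≤e graph f. If C ⊆ A is infinite, its principal function majorizes p_A
-- and its graph is computable from C, hence A ≤T graph p_C ≤T C.
-- (⇐) If A ≤e graph f, a search through finite pieces of the graph together with
-- step-bounded runs of the operator finds, computably in graph f, an element of A above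
-- any given number. Iterating it gives an increasing sequence whose range C is an
-- infinite subset of A decidable from graph f, and introreducibility gives
-- A ≤T C ≤T graph f.

module Submission where

open import Defs
open import Data.Nat using (ℕ; zero; suc; _+_; _∸_; _≤_; _<_; z≤n; s≤s; z<s; _≡ᵇ_; ⌊_/2⌋; _%_; _⊔_; pred; _<?_)
open import Data.Nat.Properties
open import Data.Bool using (Bool; true; false; if_then_else_; _∧_; _∨_; not)
open import Data.Bool.Properties using (T-≡; T-∧; ∨-zeroʳ; ∨-identityʳ)
open import Data.List using (upTo)
open import Data.List.Relation.Unary.Any using (satisfied)
open import Data.List.Relation.Unary.Any.Properties using (any⁺; any⁻)
open import Data.List.Membership.Propositional using (lose)
open import Data.List.Membership.Propositional.Properties using (∈-upTo⁺)
open import Data.Nat.DivMod using ([m+n]%n≡m%n)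
open import Data.Fin using (Fin; zero; suc; inject₁; fromℕ; _↑ʳ_)
open import Data.Vec using (Vec; []; _∷_; lookup; tabulate; _∷ʳ_; _++_; map)
open import Data.Vec.Properties using (∷-injective; tabulate∘lookup; tabulate-cong; lookup-++ʳ; map-∘; map-id)
open import Data.Product using (∃; ∃₂; _×_; _,_; proj₁; proj₂)
open import Data.Sum using (_⊎_; inj₁; inj₂)
open import Data.Empty using (⊥-elim)
open import Function.Bundles using (_⇔_; mk⇔; Equivalence)
open import Relation.Binary.PropositionalEquality using (_≡_; _≢_; refl; sym; trans; cong; cong₂; subst; subst₂; module ≡-Reasoning)
open import Relation.Binary.Definitions using (tri<; tri≈; tri>)
open import Relation.Nullary using (¬_; yes; no)

variable
  X : SetN
  k m n : ℕ

mutual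
  eval-deterministic : {P : Prog k} {xs : Vec ℕ k} {y z : ℕ} →
                       Eval X P xs y → Eval X P xs z → y ≡ z
  eval-deterministic e-zer e-zer = refl
  eval-deterministic e-succ e-succ = refl
  eval-deterministic (e-proj i) (e-proj .i) = refl
  eval-deterministic e-orc e-orc = refl
  eval-deterministic (e-comp ys g) (e-comp zs h)
    with refl ← evalVec-deterministic ys zs = eval-deterministic g h
  eval-deterministic (e-prec0 g) (e-prec0 h) = eval-deterministic g h
  eval-deterministic (e-precS g s) (e-precS h t)
    with refl ← eval-deterministic g h = eval-deterministic s t
  eval-deterministic (e-mu {n = n} z below) (e-mu {n = n′} z′ below′) with <-cmp n n′
  ... | tri< n<n′ _ _ = ⊥-elim (0≢1+n (eval-deterministic z (proj₂ (below′ n n<n′))))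
  ... | tri≈ _ n≡n′ _ = n≡n′
  ... | tri> _ _ n′<n = ⊥-elim (0≢1+n (eval-deterministic z′ (proj₂ (below n′ n′<n))))

  evalVec-deterministic : {Ps : Vec (Prog k) m} {xs : Vec ℕ k} {ys zs : Vec ℕ m} →
                          EvalVec X Ps xs ys → EvalVec X Ps xs zs → ys ≡ zs
  evalVec-deterministic ev-[] ev-[] = refl
  evalVec-deterministic (ev-∷ y ys) (ev-∷ z zs) =
    cong₂ _∷_ (eval-deterministic y z) (evalVec-deterministic ys zs)

-- Total terms compiled into oracle programs

indicator : Bool → ℕ
indicator b = if b then 1 else 0

χ : SetN → ℕ → ℕ
χ A n = indicator (A n)

1∸indicator≡0⇒true : ∀ {b} → 1 ∸ indicator b ≡ 0 → b ≡ true
1∸indicator≡0⇒true {true} _ = refl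
1∸indicator≡0⇒true {false} ()

Computes : SetN → Prog 1 → (ℕ → ℕ) → Set
Computes X P F = ∀ n → Eval X P (n ∷ []) (F n)

recℕ : ℕ → (ℕ → ℕ → ℕ) → ℕ → ℕ
recℕ z s zero = z
recℕ z s (suc n) = s n (recℕ z s n)

recℕ-cong : ∀ {z z′} {s s′ : ℕ → ℕ → ℕ} → z ≡ z′ → (∀ i r → s i r ≡ s′ i r) → ∀ n →
            recℕ z s n ≡ recℕ z′ s′ n
recℕ-cong z≡ s≡ zero = z≡
recℕ-cong {s = s} z≡ s≡ (suc n) = trans (cong (s n) (recℕ-cong z≡ s≡ n)) (s≡ n _)

ifZero : ℕ → ℕ → ℕ → ℕ
ifZero zero a b = a
ifZero (suc _) a b = b

data Term (X : SetN) : ℕ → Set where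
  var    : Fin k → Term X k
  lit    : ℕ → Term X k
  `suc   : Term X k → Term X k
  _`+_   : Term X k → Term X k → Term X k
  _`∸_   : Term X k → Term X k → Term X k
  `ifz   : Term X k → Term X k → Term X k → Term X k
  `query : Term X k → Term X k
  `rec   : Term X k → Term X (suc (suc k)) → Term X k → Term X k
  `app   : Term X m → Vec (Term X k) m → Term X k
  `embed : (P : Prog 1) (F : ℕ → ℕ) → Computes X P F → Term X k → Term X k

mutual
  ⟦_⟧ : Term X k → Vec ℕ k → ℕ
  ⟦ var i ⟧ xs = lookup xs i
  ⟦ lit n ⟧ xs = n
  ⟦ `suc t ⟧ xs = suc (⟦ t ⟧ xs)
  ⟦ t `+ u ⟧ xs = ⟦ t ⟧ xs + ⟦ u ⟧ xs
  ⟦ t `∸ u ⟧ xs = ⟦ t ⟧ xs ∸ ⟦ u ⟧ xs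
  ⟦ `ifz c t u ⟧ xs = ifZero (⟦ c ⟧ xs) (⟦ t ⟧ xs) (⟦ u ⟧ xs)
  ⟦_⟧ {X} (`query t) xs = χ X (⟦ t ⟧ xs)
  ⟦ `rec z s n ⟧ xs = recℕ (⟦ z ⟧ xs) (λ i r → ⟦ s ⟧ (i ∷ r ∷ xs)) (⟦ n ⟧ xs)
  ⟦ `app f ts ⟧ xs = ⟦ f ⟧ (⟦ ts ⟧* xs)
  ⟦ `embed P F _ t ⟧ xs = F (⟦ t ⟧ xs)

  ⟦_⟧* : Vec (Term X k) m → Vec ℕ k → Vec ℕ m
  ⟦ [] ⟧* xs = []
  ⟦ t ∷ ts ⟧* xs = ⟦ t ⟧ xs ∷ ⟦ ts ⟧* xs

addP : Prog 2
addP = prec (proj zero) (comp succ (proj (suc zero) ∷ []))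

addP-correct : ∀ a b → Eval X addP (a ∷ b ∷ []) (a + b)
addP-correct zero b = e-prec0 (e-proj zero)
addP-correct (suc a) b =
  e-precS (addP-correct a b) (e-comp (ev-∷ (e-proj (suc zero)) ev-[]) e-succ)

predP : Prog 1
predP = prec zer (proj zero)

predP-correct : ∀ n → Eval X predP (n ∷ []) (pred n)
predP-correct zero = e-prec0 e-zer
predP-correct (suc n) = e-precS (predP-correct n) (e-proj zero)

flippedMonusP : Prog 2
flippedMonusP = prec (proj zero) (comp predP (proj (suc zero) ∷ []))

flippedMonusP-correct : ∀ b a → Eval X flippedMonusP (b ∷ a ∷ []) (a ∸ b)
flippedMonusP-correct zero a = e-prec0 (e-proj zero)
flippedMonusP-correct (suc b) a =
  subst (Eval _ flippedMonusP (suc b ∷ a ∷ [])) (pred[m∸n]≡m∸[1+n] a b)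
    (e-precS (flippedMonusP-correct b a)
             (e-comp (ev-∷ (e-proj _) ev-[]) (predP-correct (a ∸ b))))

monusP : Prog 2
monusP = comp flippedMonusP (proj (suc zero) ∷ proj zero ∷ [])

monusP-correct : ∀ a b → Eval X monusP (a ∷ b ∷ []) (a ∸ b)
monusP-correct a b =
  e-comp (ev-∷ (e-proj _) (ev-∷ (e-proj _) ev-[])) (flippedMonusP-correct b a)

ifZeroP : Prog 3
ifZeroP = prec (proj zero) (proj (suc (suc (suc zero))))

ifZeroP-correct : ∀ c a b → Eval X ifZeroP (c ∷ a ∷ b ∷ []) (ifZero c a b)
ifZeroP-correct zero a b = e-prec0 (e-proj zero)
ifZeroP-correct (suc c) a b = e-precS (ifZeroP-correct c a b) (e-proj _)

constP : ℕ → Prog k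
constP zero = zer
constP (suc n) = comp succ (constP n ∷ [])

constP-correct : ∀ n {xs : Vec ℕ k} → Eval X (constP n) xs n
constP-correct zero = e-zer
constP-correct (suc n) = e-comp (ev-∷ (constP-correct n) ev-[]) e-succ

tabulate-proj-correct : ∀ {n} (f : Fin n → Fin k) {xs : Vec ℕ k} →
                        EvalVec X (tabulate (λ i → proj (f i))) xs (tabulate (λ i → lookup xs (f i)))
tabulate-proj-correct {n = zero} f = ev-[]
tabulate-proj-correct {n = suc n} f = ev-∷ (e-proj (f zero)) (tabulate-proj-correct (λ i → f (suc i)))

projections : Vec (Prog k) k
projections = tabulate proj

projections-correct : {xs : Vec ℕ k} → EvalVec X projections xs xs
projections-correct {xs = xs} =
  subst (EvalVec _ projections xs) (tabulate∘lookup xs) (tabulate-proj-correct (λ i → i))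

mutual
  compile : Term X k → Prog k
  compile (var i) = proj i
  compile (lit n) = constP n
  compile (`suc t) = comp succ (compile t ∷ [])
  compile (t `+ u) = comp addP (compile t ∷ compile u ∷ [])
  compile (t `∸ u) = comp monusP (compile t ∷ compile u ∷ [])
  compile (`ifz c t u) = comp ifZeroP (compile c ∷ compile t ∷ compile u ∷ [])
  compile (`query t) = comp orc (compile t ∷ [])
  compile (`rec z s n) = comp (prec (compile z) (compile s)) (compile n ∷ projections)
  compile (`app f ts) = comp (compile f) (compile* ts)
  compile (`embed P F _ t) = comp P (compile t ∷ [])

  compile* : Vec (Term X k) m → Vec (Prog k) m
  compile* [] = []
  compile* (t ∷ ts) = compile t ∷ compile* ts

mutual
  compile-correct : (t : Term X k) (xs : Vec ℕ k) → Eval X (compile t) xs (⟦ t ⟧ xs)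
  compile-correct (var i) xs = e-proj i
  compile-correct (lit n) xs = constP-correct n
  compile-correct (`suc t) xs = e-comp (ev-∷ (compile-correct t xs) ev-[]) e-succ
  compile-correct (t `+ u) xs =
    e-comp (ev-∷ (compile-correct t xs) (ev-∷ (compile-correct u xs) ev-[])) (addP-correct _ _)
  compile-correct (t `∸ u) xs =
    e-comp (ev-∷ (compile-correct t xs) (ev-∷ (compile-correct u xs) ev-[])) (monusP-correct _ _)
  compile-correct (`ifz c t u) xs =
    e-comp (ev-∷ (compile-correct c xs)
           (ev-∷ (compile-correct t xs) (ev-∷ (compile-correct u xs) ev-[])))
           (ifZeroP-correct _ _ _)
  compile-correct (`query t) xs = e-comp (ev-∷ (compile-correct t xs) ev-[]) e-orc
  compile-correct (`rec z s n) xs =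
    e-comp (ev-∷ (compile-correct n xs) projections-correct) (compile-rec-correct z s xs (⟦ n ⟧ xs))
  compile-correct (`app f ts) xs = e-comp (compile*-correct ts xs) (compile-correct f _)
  compile-correct (`embed P F P-computes t) xs =
    e-comp (ev-∷ (compile-correct t xs) ev-[]) (P-computes _)

  compile*-correct : (ts : Vec (Term X k) m) (xs : Vec ℕ k) →
                     EvalVec X (compile* ts) xs (⟦ ts ⟧* xs)
  compile*-correct [] xs = ev-[]
  compile*-correct (t ∷ ts) xs = ev-∷ (compile-correct t xs) (compile*-correct ts xs)

  compile-rec-correct : (z : Term X k) (s : Term X (suc (suc k))) (xs : Vec ℕ k) (n : ℕ) →
    Eval X (prec (compile z) (compile s)) (n ∷ xs) (recℕ (⟦ z ⟧ xs) (λ i r → ⟦ s ⟧ (i ∷ r ∷ xs)) n)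
  compile-rec-correct z s xs zero = e-prec0 (compile-correct z xs)
  compile-rec-correct z s xs (suc n) =
    e-precS (compile-rec-correct z s xs n) (compile-correct s _)

compile-correct′ : (t : Term X k) {xs : Vec ℕ k} {y : ℕ} → ⟦ t ⟧ xs ≡ y → Eval X (compile t) xs y
compile-correct′ t {xs} refl = compile-correct t xs

LeastZero : (ℕ → ℕ) → ℕ → Set
LeastZero F j = F j ≡ 0 × (∀ i → i < j → ∃ λ v → F i ≡ suc v)

least-zero : (F : ℕ → ℕ) (w : ℕ) → F w ≡ 0 → ∃ (LeastZero F)
least-zero F zero Fw≡0 = 0 , Fw≡0 , λ _ ()
least-zero F (suc w) Fw≡0 with F 0 in F0
... | zero = 0 , F0 , λ _ ()
... | suc v with least-zero (λ i → F (suc i)) w Fw≡0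
...   | j , Fj≡0 , below = suc j , Fj≡0 , λ where
          zero _ → v , F0
          (suc i) (s≤s i<j) → below i i<j

mu-correct : (t : Term X (suc k)) (xs : Vec ℕ k) {j : ℕ} →
             LeastZero (λ i → ⟦ t ⟧ (i ∷ xs)) j → Eval X (mu (compile t)) xs j
mu-correct t xs (tj≡0 , below) =
  e-mu (compile-correct′ t tj≡0)
       (λ i i<j → proj₁ (below i i<j) , compile-correct′ t (proj₂ (below i i<j)))

term-≤T : ∀ {A} (t : Term X 1) → (∀ n → ⟦ t ⟧ (n ∷ []) ≡ χ A n) → A ≤T X
term-≤T t spec = compile t , λ n → compile-correct′ t (spec n)

tri-mono-≤ : m ≤ n → tri m ≤ tri n
tri-mono-≤ {zero} _ = z≤n
tri-mono-≤ {suc m} {suc n} (s≤s m≤n) = +-mono-≤ (s≤s m≤n) (tri-mono-≤ m≤n)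

n≤tri[n] : ∀ n → n ≤ tri n
n≤tri[n] zero = z≤n
n≤tri[n] (suc n) = m≤m+n (suc n) (tri n)

x≤pair : ∀ x y → x ≤ pair x y
x≤pair x y = ≤-trans (≤-trans (m≤m+n x y) (n≤tri[n] (x + y))) (m≤m+n _ y)

y≤pair : ∀ x y → y ≤ pair x y
y≤pair x y = ≤-trans (≤-trans (m≤n+m y x) (n≤tri[n] (x + y))) (m≤m+n _ y)

diagonal : ℕ → ℕ
diagonal zero = 0
diagonal (suc k) = ifZero (tri (suc (diagonal k)) ∸ suc k) (suc (diagonal k)) (diagonal k)

OnDiagonal : ℕ → ℕ → Set
OnDiagonal k d = tri d ≤ k × k < tri (suc d)

diagonal-spec : ∀ k → OnDiagonal k (diagonal k)
diagonal-spec zero = z≤n , s≤s z≤n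
diagonal-spec (suc k) with diagonal-spec k | tri (suc (diagonal k)) ∸ suc k in gap
... | low , high | zero =
  ≤-reflexive next≡ , subst (_< tri (suc (suc d))) next≡ (m<n+m (tri (suc d)) {suc (suc d)} z<s)
  where
  d = diagonal k
  next≡ : tri (suc d) ≡ suc k
  next≡ = ≤-antisym (m∸n≡0⇒m≤n gap) high
... | low , high | suc _ = m≤n⇒m≤1+n low , m∸n≢0⇒n<m (λ gap≡0 → 0≢1+n (trans (sym gap≡0) gap))

OnDiagonal-unique : ∀ {d e} → OnDiagonal k d → OnDiagonal k e → d ≡ e
OnDiagonal-unique {d = d} {e} (low , high) (low′ , high′) with <-cmp d e
... | tri< d<e _ _ = ⊥-elim (<⇒≱ high (≤-trans (tri-mono-≤ d<e) low′))
... | tri≈ _ d≡e _ = d≡e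
... | tri> _ _ e<d = ⊥-elim (<⇒≱ high′ (≤-trans (tri-mono-≤ e<d) low))

diagonal-pair : ∀ x y → diagonal (pair x y) ≡ x + y
diagonal-pair x y = OnDiagonal-unique (diagonal-spec (pair x y)) (m≤m+n _ y , below)
  where
  below : pair x y < tri (suc (x + y))
  below = subst (pair x y <_) (+-comm (tri (x + y)) (suc (x + y)))
                (+-monoʳ-< (tri (x + y)) (s≤s (m≤n+m y x)))

unpair₁ unpair₂ : ℕ → ℕ
unpair₂ k = k ∸ tri (diagonal k)
unpair₁ k = diagonal k ∸ unpair₂ k

unpair₂≤diagonal : ∀ k → unpair₂ k ≤ diagonal k
unpair₂≤diagonal k with diagonal-spec k
... | _ , high = ≤-trans (∸-monoˡ-≤ (tri (diagonal k)) (≤-pred high))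
                         (≤-reflexive (m+n∸n≡m (diagonal k) (tri (diagonal k))))

pair-unpair : ∀ k → pair (unpair₁ k) (unpair₂ k) ≡ k
pair-unpair k = trans (cong (λ d → tri d + unpair₂ k) (m∸n+n≡m (unpair₂≤diagonal k)))
                      (m+[n∸m]≡n (proj₁ (diagonal-spec k)))

unpair₂-pair : ∀ x y → unpair₂ (pair x y) ≡ y
unpair₂-pair x y rewrite diagonal-pair x y = m+n∸m≡n (tri (x + y)) y

unpair₁-pair : ∀ x y → unpair₁ (pair x y) ≡ x
unpair₁-pair x y rewrite unpair₂-pair x y | diagonal-pair x y = m+n∸n≡m x y

unpair₁≤ : ∀ k → unpair₁ k ≤ k
unpair₁≤ k = subst (unpair₁ k ≤_) (pair-unpair k) (x≤pair (unpair₁ k) (unpair₂ k))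

triT : Term X 1
triT = `rec (lit 0) (`suc (var zero) `+ var (suc zero)) (var zero)

⟦triT⟧ : ∀ n → ⟦ triT {X} ⟧ (n ∷ []) ≡ tri n
⟦triT⟧ zero = refl
⟦triT⟧ {X} (suc n) = cong (suc n +_) (⟦triT⟧ {X} n)

diagonalT : Term X 1
diagonalT = `rec (lit 0)
                 (`ifz (`app triT (`suc (var (suc zero)) ∷ []) `∸ `suc (var zero))
                       (`suc (var (suc zero)))
                       (var (suc zero)))
                 (var zero)

⟦diagonalT⟧ : ∀ k → ⟦ diagonalT {X} ⟧ (k ∷ []) ≡ diagonal k
⟦diagonalT⟧ zero = refl
⟦diagonalT⟧ {X} (suc k) rewrite ⟦diagonalT⟧ {X} k | ⟦triT⟧ {X} (diagonal k) = refl

unpair₁T unpair₂T : Term X 1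
unpair₂T = var zero `∸ `app triT (diagonalT ∷ [])
unpair₁T = diagonalT `∸ unpair₂T

⟦unpair₂T⟧ : ∀ k → ⟦ unpair₂T {X} ⟧ (k ∷ []) ≡ unpair₂ k
⟦unpair₂T⟧ {X} k rewrite ⟦diagonalT⟧ {X} k | ⟦triT⟧ {X} (diagonal k) = refl

⟦unpair₁T⟧ : ∀ k → ⟦ unpair₁T {X} ⟧ (k ∷ []) ≡ unpair₁ k
⟦unpair₁T⟧ {X} k = cong₂ _∸_ (⟦diagonalT⟧ {X} k) (⟦unpair₂T⟧ {X} k)

pairT : Term X 2
pairT = `app triT ((var zero `+ var (suc zero)) ∷ []) `+ var (suc zero)

⟦pairT⟧ : ∀ x y → ⟦ pairT {X} ⟧ (x ∷ y ∷ []) ≡ pair x y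
⟦pairT⟧ {X} x y = cong (_+ y) (⟦triT⟧ {X} (x + y))

≡ᵇ-true⇒≡ : ∀ {a b} → (a ≡ᵇ b) ≡ true → a ≡ b
≡ᵇ-true⇒≡ eq = ≡ᵇ⇒≡ _ _ (Equivalence.from T-≡ eq)

≡⇒≡ᵇ-true : ∀ {a b} → a ≡ b → (a ≡ᵇ b) ≡ true
≡⇒≡ᵇ-true {a} eq = Equivalence.to T-≡ (≡⇒≡ᵇ a _ eq)

≡true-ext : ∀ {b c : Bool} → (b ≡ true → c ≡ true) → (c ≡ true → b ≡ true) → b ≡ c
≡true-ext {true} to _ = sym (to refl)
≡true-ext {false} {false} _ _ = refl
≡true-ext {false} {true} _ from = from refl

∨≡true⁻ : ∀ b {c} → b ∨ c ≡ true → b ≡ true ⊎ c ≡ true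
∨≡true⁻ true _ = inj₁ refl
∨≡true⁻ false c≡true = inj₂ c≡true

_`≟_ : Term X k → Term X k → Term X k
t `≟ u = `ifz ((t `∸ u) `+ (u `∸ t)) (lit 1) (lit 0)

⟦≟⟧ : (t u : Term X k) (xs : Vec ℕ k) → ⟦ t `≟ u ⟧ xs ≡ indicator (⟦ t ⟧ xs ≡ᵇ ⟦ u ⟧ xs)
⟦≟⟧ t u xs = go (⟦ t ⟧ xs) (⟦ u ⟧ xs)
  where
  go : ∀ a b → ifZero ((a ∸ b) + (b ∸ a)) 1 0 ≡ indicator (a ≡ᵇ b)
  go zero zero = refl
  go zero (suc b) = refl
  go (suc a) zero = refl
  go (suc a) (suc b) = go a b

graph-sound : ∀ f k → graph f k ≡ true → f (unpair₁ k) ≡ unpair₂ k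
graph-sound f k gk
  with x , Tx ← satisfied (any⁻ _ (upTo (suc k)) (Equivalence.from T-≡ gk))
  with y , Txy ← satisfied (any⁻ _ (upTo (suc k)) Tx)
  with pair≡ , fx≡ ← Equivalence.to T-∧ Txy
  with refl ← ≡ᵇ⇒≡ (pair x y) k pair≡ | refl ← ≡ᵇ⇒≡ (f x) y fx≡
  rewrite unpair₁-pair x (f x) | unpair₂-pair x (f x) = refl

graph-complete : ∀ f x → graph f (pair x (f x)) ≡ true
graph-complete f x = Equivalence.to T-≡
  (any⁺ _ (lose (∈-upTo⁺ (s≤s (x≤pair x (f x))))
  (any⁺ _ (lose (∈-upTo⁺ (s≤s (y≤pair x (f x))))
  (Equivalence.from T-∧ (≡⇒≡ᵇ (pair x (f x)) _ refl , ≡⇒≡ᵇ (f x) _ refl))))))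

graph-≡ᵇ : ∀ f k → graph f k ≡ (f (unpair₁ k) ≡ᵇ unpair₂ k)
graph-≡ᵇ f k = ≡true-ext (λ gk → ≡⇒≡ᵇ-true (graph-sound f k gk)) complete
  where
  complete : (f (unpair₁ k) ≡ᵇ unpair₂ k) ≡ true → graph f k ≡ true
  complete eq = subst (λ j → graph f j ≡ true)
                      (trans (cong (pair (unpair₁ k)) (≡ᵇ-true⇒≡ eq)) (pair-unpair k))
                      (graph-complete f (unpair₁ k))

parity : ℕ → ℕ
parity zero = 0
parity (suc zero) = 1
parity (suc (suc n)) = parity n

parity-suc : ∀ n → parity (suc n) ≡ ifZero (parity n) 1 0
parity-suc zero = refl
parity-suc (suc zero) = refl
parity-suc (suc (suc n)) = parity-suc n

n%2≡parity : ∀ n → n % 2 ≡ parity n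
n%2≡parity zero = refl
n%2≡parity (suc zero) = refl
n%2≡parity (suc (suc n)) =
  trans (trans (cong (_% 2) (+-comm 2 n)) ([m+n]%n≡m%n n 2)) (n%2≡parity n)

bit-zero : ∀ u → bit u 0 ≡ (parity u ≡ᵇ 1)
bit-zero u = cong (_≡ᵇ 1) (n%2≡parity u)

indicator-bit-zero : ∀ u → indicator (bit u 0) ≡ parity u
indicator-bit-zero u rewrite bit-zero u = go u
  where
  go : ∀ u → indicator (parity u ≡ᵇ 1) ≡ parity u
  go zero = refl
  go (suc zero) = refl
  go (suc (suc u)) = go u

⌊1+n/2⌋≡⌊n/2⌋+parity : ∀ n → ⌊ suc n /2⌋ ≡ ⌊ n /2⌋ + parity n
⌊1+n/2⌋≡⌊n/2⌋+parity zero = refl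
⌊1+n/2⌋≡⌊n/2⌋+parity (suc zero) = refl
⌊1+n/2⌋≡⌊n/2⌋+parity (suc (suc n)) = cong suc (⌊1+n/2⌋≡⌊n/2⌋+parity n)

halvings : ℕ → ℕ → ℕ
halvings u = recℕ u (λ _ r → ⌊ r /2⌋)

bit-halvings : ∀ u m j → bit (halvings u m) j ≡ bit u (m + j)
bit-halvings u zero j = refl
bit-halvings u (suc m) j = trans (bit-halvings u m (suc j)) (cong (bit u) (+-suc m j))

bit-large : ∀ u m → u ≤ m → bit u m ≡ false
bit-large zero m _ = bit-of-zero m
  where
  bit-of-zero : ∀ m → bit 0 m ≡ false
  bit-of-zero zero = refl
  bit-of-zero (suc m) = bit-of-zero m
bit-large (suc u) (suc m) (s≤s u≤m) = bit-large ⌊ suc u /2⌋ m (≤-trans (≤-pred (⌊n/2⌋<n u)) u≤m)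

parityT : Term X 1
parityT = `rec (lit 0) (`ifz (var (suc zero)) (lit 1) (lit 0)) (var zero)

⟦parityT⟧ : ∀ n → ⟦ parityT {X} ⟧ (n ∷ []) ≡ parity n
⟦parityT⟧ zero = refl
⟦parityT⟧ {X} (suc n) = trans (cong (λ p → ifZero p 1 0) (⟦parityT⟧ {X} n)) (sym (parity-suc n))

halfT : Term X 1
halfT = `rec (lit 0) (var (suc zero) `+ `app parityT (var zero ∷ [])) (var zero)

⟦halfT⟧ : ∀ n → ⟦ halfT {X} ⟧ (n ∷ []) ≡ ⌊ n /2⌋
⟦halfT⟧ zero = refl
⟦halfT⟧ {X} (suc n) =
  trans (cong₂ _+_ (⟦halfT⟧ {X} n) (⟦parityT⟧ {X} n)) (sym (⌊1+n/2⌋≡⌊n/2⌋+parity n))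

bitT : Term X 2
bitT = `app parityT (`rec (var zero) (`app halfT (var (suc zero) ∷ [])) (var (suc zero)) ∷ [])

⟦bitT⟧ : ∀ u m → ⟦ bitT {X} ⟧ (u ∷ m ∷ []) ≡ indicator (bit u m)
⟦bitT⟧ {X} u m = begin
  ⟦ parityT {X} ⟧ (halved ∷ [])      ≡⟨ ⟦parityT⟧ {X} halved ⟩
  parity halved                      ≡⟨ cong parity (recℕ-cong refl (λ _ r → ⟦halfT⟧ {X} r) m) ⟩
  parity (halvings u m)              ≡⟨ sym (indicator-bit-zero (halvings u m)) ⟩
  indicator (bit (halvings u m) 0)   ≡⟨ cong indicator (bit-halvings u m 0) ⟩
  indicator (bit u (m + 0))          ≡⟨ cong (λ j → indicator (bit u j)) (+-identityʳ m) ⟩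
  indicator (bit u m)                ∎
  where
  open ≡-Reasoning
  halved : ℕ
  halved = recℕ u (λ _ r → ⟦ halfT {X} ⟧ (r ∷ [])) m

consBit : Bool → ℕ → ℕ
consBit b zero = indicator b
consBit b (suc v) = suc (suc (consBit b v))

bit-consBit-zero : ∀ b v → bit (consBit b v) 0 ≡ b
bit-consBit-zero b v = trans (bit-zero (consBit b v)) (go b v)
  where
  go : ∀ b v → (parity (consBit b v) ≡ᵇ 1) ≡ b
  go true zero = refl
  go false zero = refl
  go b (suc v) = go b v

⌊consBit/2⌋ : ∀ b v → ⌊ consBit b v /2⌋ ≡ v
⌊consBit/2⌋ true zero = refl
⌊consBit/2⌋ false zero = refl
⌊consBit/2⌋ b (suc v) = cong suc (⌊consBit/2⌋ b v)

insert : ℕ → ℕ → ℕ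
insert u zero = consBit true ⌊ u /2⌋
insert u (suc m) = consBit (bit u 0) (insert ⌊ u /2⌋ m)

bit-insert : ∀ u m j → bit (insert u m) j ≡ (bit u j ∨ (j ≡ᵇ m))
bit-insert u zero zero = trans (bit-consBit-zero true ⌊ u /2⌋) (sym (∨-zeroʳ (bit u 0)))
bit-insert u zero (suc j) =
  trans (cong (λ v → bit v j) (⌊consBit/2⌋ true _)) (sym (∨-identityʳ (bit u (suc j))))
bit-insert u (suc m) zero =
  trans (bit-consBit-zero (bit u 0) (insert ⌊ u /2⌋ m)) (sym (∨-identityʳ (bit u 0)))
bit-insert u (suc m) (suc j) =
  trans (cong (λ v → bit v j) (⌊consBit/2⌋ (bit u 0) _)) (bit-insert ⌊ u /2⌋ m j)

misses : SetN → ℕ → ℕ → ℕ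
misses X u zero = 0
misses X u (suc i) = misses X u i + indicator (bit u i ∧ not (X i))

misses≡0⇒D⊆ : ∀ u → misses X u u ≡ 0 → D u ⊆ X
misses≡0⇒D⊆ {X} u none j bit-j with j <? u
... | yes j<u = below u none j<u
  where
  below : ∀ n → misses X u n ≡ 0 → j < n → X j ≡ true
  below (suc n) none j<1+n with m<1+n⇒m<n∨m≡n j<1+n
  ... | inj₁ j<n = below n (m+n≡0⇒m≡0 _ none) j<n
  ... | inj₂ refl with X j | m+n≡0⇒n≡0 (misses X u j) none
  ...   | true | _ = refl
  ...   | false | miss rewrite bit-j = ⊥-elim (0≢1+n (sym miss))
... | no j≮u = ⊥-elim (0≢1+n (cong indicator (trans (sym (bit-large u j (≮⇒≥ j≮u))) bit-j)))

D⊆⇒misses≡0 : ∀ u n → D u ⊆ X → misses X u n ≡ 0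
D⊆⇒misses≡0 u zero _ = refl
D⊆⇒misses≡0 {X} u (suc n) D⊆X rewrite D⊆⇒misses≡0 u n D⊆X with bit u n in bit-n
... | false = refl
... | true rewrite D⊆X n bit-n = refl

missesT : Term X 1
missesT = `rec (lit 0)
               (var (suc zero) `+ `ifz (`app bitT (var (suc (suc zero)) ∷ var zero ∷ []))
                                       (lit 0) (lit 1 `∸ `query (var zero)))
               (var zero)

⟦missesT⟧ : ∀ u → ⟦ missesT {X} ⟧ (u ∷ []) ≡ misses X u u
⟦missesT⟧ {X} u = go u
  where
  step : ∀ b c → ifZero (indicator b) 0 (1 ∸ indicator c) ≡ indicator (b ∧ not c)
  step false c = refl
  step true false = refl
  step true true = refl
  go : ∀ n → recℕ 0 (λ i r → r + ifZero (⟦ bitT {X} ⟧ (u ∷ i ∷ [])) 0 (1 ∸ χ X i)) n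
             ≡ misses X u n
  go zero = refl
  go (suc n) = cong₂ _+_ (go n)
    (trans (cong (λ b → ifZero b 0 (1 ∸ χ X n)) (⟦bitT⟧ {X} u n)) (step (bit u n) (X n)))

-- The use principle

Eventually : (ℕ → Set) → Set
Eventually Q = ∃ λ N → ∀ {t} → N ≤ t → Q t

eventually-× : ∀ {Q R : ℕ → Set} → Eventually Q → Eventually R → Eventually (λ t → Q t × R t)
eventually-× (M , q) (N , r) =
  M ⊔ N , λ le → q (≤-trans (m≤m⊔n M N) le) , r (≤-trans (m≤n⊔m M N) le)

eventually-map : ∀ {Q R : ℕ → Set} → (∀ {t} → Q t → R t) → Eventually Q → Eventually R
eventually-map f (N , q) = N , λ le → f (q le)

eventually-∀< : (Q : ℕ → ℕ → Set) (n : ℕ) →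
  (∀ i → i < n → Eventually (Q i)) → Eventually (λ t → ∀ i → i < n → Q i t)
eventually-∀< Q zero _ = 0 , λ _ _ ()
eventually-∀< Q (suc n) each
  with N , both ← eventually-× (eventually-∀< Q n (λ i i<n → each i (m<n⇒m<1+n i<n)))
                               (each n (n<1+n n))
  = N , λ le i i<1+n → case (m<1+n⇒m<n∨m≡n i<1+n) (both le)
  where
  case : ∀ {i t} → i < n ⊎ i ≡ n → (∀ j → j < n → Q j t) × Q n t → Q i t
  case (inj₁ i<n) (below , _) = below _ i<n
  case (inj₂ refl) (_ , at-n) = at-n

lookup-inject₁ : (xs : Vec ℕ k) (u : ℕ) (i : Fin k) → lookup (xs ∷ʳ u) (inject₁ i) ≡ lookup xs i
lookup-inject₁ (x ∷ xs) u zero = refl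
lookup-inject₁ (x ∷ xs) u (suc i) = lookup-inject₁ xs u i

lookup-fromℕ : (xs : Vec ℕ k) (u : ℕ) → lookup (xs ∷ʳ u) (fromℕ k) ≡ u
lookup-fromℕ [] u = refl
lookup-fromℕ (x ∷ xs) u = lookup-fromℕ xs u

evalVec-∷ʳ⁺ : {Ps : Vec (Prog k) m} {P : Prog k} {xs : Vec ℕ k} {ys : Vec ℕ m} {y : ℕ} →
              EvalVec X Ps xs ys → Eval X P xs y → EvalVec X (Ps ∷ʳ P) xs (ys ∷ʳ y)
evalVec-∷ʳ⁺ ev-[] e = ev-∷ e ev-[]
evalVec-∷ʳ⁺ (ev-∷ e′ es) e = ev-∷ e′ (evalVec-∷ʳ⁺ es e)

evalVec-∷ʳ⁻ : (Ps : Vec (Prog k) m) {P : Prog k} {xs : Vec ℕ k} {zs : Vec ℕ (suc m)} →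
              EvalVec X (Ps ∷ʳ P) xs zs →
              ∃₂ λ ys z → zs ≡ ys ∷ʳ z × EvalVec X Ps xs ys × Eval X P xs z
evalVec-∷ʳ⁻ [] (ev-∷ e ev-[]) = [] , _ , refl , ev-[] , e
evalVec-∷ʳ⁻ (_ ∷ Ps) (ev-∷ e es) with ys , z , refl , es′ , e′ ← evalVec-∷ʳ⁻ Ps es =
  _ ∷ ys , z , refl , ev-∷ e es′ , e′

-- relativize O P answers each oracle query n of P by running O on (n , u), where the
-- parameter u is passed to every subprogram as an extra last argument.
mutual
  relativize : Prog 2 → Prog k → Prog (suc k)
  relativize O zer = zer
  relativize O succ = comp succ (proj zero ∷ [])
  relativize O (proj i) = proj (inject₁ i)
  relativize O orc = O
  relativize O (comp {k} g hs) = comp (relativize O g) (relativize* O hs ∷ʳ proj (fromℕ k))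
  relativize O (prec g s) = prec (relativize O g) (relativize O s)
  relativize O (mu f) = mu (relativize O f)

  relativize* : Prog 2 → Vec (Prog k) m → Vec (Prog (suc k)) m
  relativize* O [] = []
  relativize* O (h ∷ hs) = relativize O h ∷ relativize* O hs

OracleUpTo : SetN → SetN → Prog 2 → ℕ → ℕ → Set
OracleUpTo X Y O u N = ∀ n → n ≤ N → Eval Y O (n ∷ u ∷ []) (χ X n)

SoundOracle : SetN → SetN → Prog 2 → ℕ → Set
SoundOracle X Y O u = ∀ n v → Eval Y O (n ∷ u ∷ []) v → v ≡ χ X n

RelativizesTo : SetN → SetN → Prog 2 → Prog k → Vec ℕ k → ℕ → ℕ → Set
RelativizesTo X Y O P xs y N = ∀ u → OracleUpTo X Y O u N → Eval Y (relativize O P) (xs ∷ʳ u) y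

module _ {X Y : SetN} {O : Prog 2} where

  mutual
    relativize-complete : {P : Prog k} {xs : Vec ℕ k} {y : ℕ} →
                          Eval X P xs y → Eventually (RelativizesTo X Y O P xs y)
    relativize-complete e-zer = 0 , λ _ _ _ → e-zer
    relativize-complete e-succ = 0 , λ _ _ _ → e-comp (ev-∷ (e-proj zero) ev-[]) e-succ
    relativize-complete {xs = xs} (e-proj i) =
      0 , λ _ u _ → subst (Eval Y _ (xs ∷ʳ u)) (lookup-inject₁ xs u i) (e-proj (inject₁ i))
    relativize-complete (e-orc {n}) = n , λ n≤N u oracle → oracle n n≤N
    relativize-complete {xs = xs} (e-comp {k = k} es e) =
      eventually-map
        (λ (es′ , e′) u oracle →
          e-comp (evalVec-∷ʳ⁺ (es′ u oracle)
                              (subst (Eval Y _ (xs ∷ʳ u)) (lookup-fromℕ xs u) (e-proj (fromℕ k))))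
                 (e′ u oracle))
        (eventually-× (relativize*-complete es) (relativize-complete e))
    relativize-complete (e-prec0 e) =
      eventually-map (λ e′ u oracle → e-prec0 (e′ u oracle)) (relativize-complete e)
    relativize-complete (e-precS e₁ e₂) =
      eventually-map (λ (e₁′ , e₂′) u oracle → e-precS (e₁′ u oracle) (e₂′ u oracle))
        (eventually-× (relativize-complete e₁) (relativize-complete e₂))
    relativize-complete {xs = xs} (e-mu {f = f} {n = n} z below) =
      eventually-map (λ (z′ , below′) u oracle → e-mu (z′ u oracle) (λ i i<n → below′ i i<n u oracle))
        (eventually-× (relativize-complete z)
          (eventually-∀< (λ i N → ∀ u → OracleUpTo X Y O u N →
                                   ∃ λ v → Eval Y (relativize O f) ((i ∷ xs) ∷ʳ u) (suc v)) n
             (λ i i<n → eventually-map (λ e′ u oracle → proj₁ (below i i<n) , e′ u oracle)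
                                       (relativize-complete (proj₂ (below i i<n))))))

    relativize*-complete : {Ps : Vec (Prog k) m} {xs : Vec ℕ k} {ys : Vec ℕ m} →
      EvalVec X Ps xs ys →
      Eventually (λ N → ∀ u → OracleUpTo X Y O u N → EvalVec Y (relativize* O Ps) (xs ∷ʳ u) ys)
    relativize*-complete ev-[] = 0 , λ _ _ _ → ev-[]
    relativize*-complete (ev-∷ e es) =
      eventually-map (λ (e′ , es′) u oracle → ev-∷ (e′ u oracle) (es′ u oracle))
        (eventually-× (relativize-complete e) (relativize*-complete es))

  mutual
    relativize-sound : (P : Prog k) {xs : Vec ℕ k} {u y : ℕ} → SoundOracle X Y O u →
                       Eval Y (relativize O P) (xs ∷ʳ u) y → Eval X P xs y
    relativize-sound zer _ e-zer = e-zer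
    relativize-sound succ {_ ∷ []} _ (e-comp (ev-∷ (e-proj zero) ev-[]) e-succ) = e-succ
    relativize-sound (proj i) {xs} {u} _ (e-proj _) =
      subst (Eval X (proj i) xs) (sym (lookup-inject₁ xs u i)) (e-proj i)
    relativize-sound orc {n ∷ []} sound e = subst (Eval X orc (n ∷ [])) (sym (sound n _ e)) e-orc
    relativize-sound (comp g hs) {xs} {u} {y} sound (e-comp es e)
      with ys , _ , refl , es′ , e-proj _ ← evalVec-∷ʳ⁻ (relativize* O hs) es =
      e-comp (relativize*-sound hs sound es′)
             (relativize-sound g sound
               (subst (λ z → Eval Y (relativize O g) (ys ∷ʳ z) y) (lookup-fromℕ xs u) e))
    relativize-sound (prec g s) {zero ∷ _} sound (e-prec0 e) = e-prec0 (relativize-sound g sound e)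
    relativize-sound (prec g s) {suc _ ∷ _} sound (e-precS e₁ e₂) =
      e-precS (relativize-sound (prec g s) sound e₁) (relativize-sound s sound e₂)
    relativize-sound (mu f) sound (e-mu z below) =
      e-mu (relativize-sound f sound z)
           (λ i i<n → proj₁ (below i i<n) , relativize-sound f sound (proj₂ (below i i<n)))

    relativize*-sound : (Ps : Vec (Prog k) m) {xs : Vec ℕ k} {u : ℕ} {ys : Vec ℕ m} →
                        SoundOracle X Y O u →
                        EvalVec Y (relativize* O Ps) (xs ∷ʳ u) ys → EvalVec X Ps xs ys
    relativize*-sound [] _ ev-[] = ev-[]
    relativize*-sound (P ∷ Ps) sound (ev-∷ e es) =
      ev-∷ (relativize-sound P sound e) (relativize*-sound Ps sound es)

≤T-trans : ∀ {A B C} → A ≤T B → B ≤T C → A ≤T C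
≤T-trans {A} {B} {C} (P , P-computes) (Q , Q-computes) =
  comp (relativize O P) (proj zero ∷ constP 0 ∷ []) ,
  λ n → e-comp (ev-∷ (e-proj zero) (ev-∷ (constP-correct 0) ev-[]))
               (proj₂ (relativize-complete (P-computes n)) ≤-refl 0 oracle)
  where
  O : Prog 2
  O = comp Q (proj zero ∷ [])
  oracle : ∀ {N} → OracleUpTo B C O 0 N
  oracle n _ = e-comp (ev-∷ (e-proj zero) ev-[]) (Q-computes n)

Increasing : (ℕ → ℕ) → Set
Increasing p = ∀ n → p n < p (suc n)

increasing-mono-≤ : ∀ {p} → Increasing p → m ≤ n → p m ≤ p n
increasing-mono-≤ {n = zero} inc z≤n = ≤-refl
increasing-mono-≤ {n = suc n} inc m≤1+n with m≤n⇒m<n∨m≡n m≤1+n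
... | inj₁ m<1+n = ≤-trans (increasing-mono-≤ inc (≤-pred m<1+n)) (<⇒≤ (inc n))
... | inj₂ refl = ≤-refl

increasing-cancel-< : ∀ {p} → Increasing p → p m < p n → m < n
increasing-cancel-< {m} {n} inc pm<pn with m <? n
... | yes m<n = m<n
... | no m≮n = ⊥-elim (<⇒≱ pm<pn (increasing-mono-≤ inc (≮⇒≥ m≮n)))

increasing⇒n≤ : ∀ {p} → Increasing p → ∀ n → n ≤ p n
increasing⇒n≤ inc zero = z≤n
increasing⇒n≤ inc (suc n) = ≤-trans (s≤s (increasing⇒n≤ inc n)) (inc n)

principal-minimal : ∀ {A p q} → IsPrincipal A p → Increasing q → (∀ n → A (q n) ≡ true) →
                    Majorizes q p
principal-minimal {A} {p} {q} (p-inc , p-onto) q-inc q-in n =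
  subst (p n ≤_) (proj₂ (index n)) (increasing-mono-≤ p-inc (increasing⇒n≤ index-inc n))
  where
  index : ∀ n → ∃ λ j → p j ≡ q n
  index n = Equivalence.to (p-onto (q n)) (q-in n)
  index-inc : Increasing (λ n → proj₁ (index n))
  index-inc n = increasing-cancel-< p-inc
    (subst₂ _<_ (sym (proj₂ (index n))) (sym (proj₂ (index (suc n)))) (q-inc n))

module Principal (A : SetN) (A-infinite : Infinite A) where

  offset-spec : ∀ r → ∃ (LeastZero (λ j → 1 ∸ χ A (r + j)))
  offset-spec r with m , r≤m , m∈A ← A-infinite r =
    least-zero _ (m ∸ r) (subst (λ i → 1 ∸ χ A i ≡ 0) (sym (m+[n∸m]≡n r≤m))
                                (cong (λ b → 1 ∸ indicator b) m∈A))

  offset : ℕ → ℕ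
  offset r = proj₁ (offset-spec r)

  next : ℕ → ℕ
  next r = r + offset r

  next-∈ : ∀ r → A (next r) ≡ true
  next-∈ r = 1∸indicator≡0⇒true (proj₁ (proj₂ (offset-spec r)))

  next-least : ∀ {r m} → r ≤ m → A m ≡ true → next r ≤ m
  next-least {r} {m} r≤m m∈A with m <? next r
  ... | no m≮next = ≮⇒≥ m≮next
  ... | yes m<next = ⊥-elim (0≢1+n (trans (sym m∉A) (proj₂ below)))
    where
    r+[m∸r]≡m : r + (m ∸ r) ≡ m
    r+[m∸r]≡m = m+[n∸m]≡n r≤m
    below : ∃ λ v → 1 ∸ χ A (r + (m ∸ r)) ≡ suc v
    below = proj₂ (proj₂ (offset-spec r)) (m ∸ r)
              (+-cancelˡ-< r _ _ (subst (_< next r) (sym r+[m∸r]≡m) m<next))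
    m∉A : 1 ∸ χ A (r + (m ∸ r)) ≡ 0
    m∉A = trans (cong (λ i → 1 ∸ χ A i) r+[m∸r]≡m) (cong (λ b → 1 ∸ indicator b) m∈A)

  principal : ℕ → ℕ
  principal zero = next 0
  principal (suc n) = next (suc (principal n))

  principal-increasing : Increasing principal
  principal-increasing n = m≤m+n (suc (principal n)) _

  principal-∈ : ∀ n → A (principal n) ≡ true
  principal-∈ zero = next-∈ 0
  principal-∈ (suc n) = next-∈ (suc (principal n))

  principal-onto : ∀ m → A m ≡ true → ∃ λ n → principal n ≡ m
  principal-onto m m∈A
    with least-zero (λ n → m ∸ principal n) m
                    (m≤n⇒m∸n≡0 (increasing⇒n≤ principal-increasing m))
  ... | zero , m≤p , _ = zero , ≤-antisym (next-least z≤n m∈A) (m∸n≡0⇒m≤n m≤p)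
  ... | suc n , m≤p , below with _ , m∸p≡1+v ← below n (n<1+n n) =
    suc n , ≤-antisym (next-least (m∸n≢0⇒n<m (λ eq → 0≢1+n (trans (sym eq) m∸p≡1+v))) m∈A)
                      (m∸n≡0⇒m≤n m≤p)

  principal-isPrincipal : IsPrincipal A principal
  principal-isPrincipal =
    principal-increasing , λ m → mk⇔ (principal-onto m) (λ { (n , refl) → principal-∈ n })

  offset-searchT : Term A 2
  offset-searchT = lit 1 `∸ `query (var (suc zero) `+ var zero)

  offset-computable : Computes A (mu (compile offset-searchT)) offset
  offset-computable r = mu-correct offset-searchT (r ∷ []) (proj₂ (offset-spec r))

  principalT : Term A 1
  principalT = `rec (offsetT (lit 0))
                    (`suc (var (suc zero)) `+ offsetT (`suc (var (suc zero))))
                    (var zero)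
    where
    offsetT : Term A k → Term A k
    offsetT = `embed _ offset offset-computable

  ⟦principalT⟧ : ∀ n → ⟦ principalT ⟧ (n ∷ []) ≡ principal n
  ⟦principalT⟧ zero = refl
  ⟦principalT⟧ (suc n) = cong (λ r → suc r + offset (suc r)) (⟦principalT⟧ n)

  graph-principal-≤T : graph principal ≤T A
  graph-principal-≤T = term-≤T (`app principalT (unpair₁T ∷ []) `≟ unpair₂T) spec
    where
    spec : ∀ k → ⟦ `app principalT (unpair₁T ∷ []) `≟ unpair₂T ⟧ (k ∷ []) ≡ χ (graph principal) k
    spec k rewrite ⟦≟⟧ (`app principalT (unpair₁T ∷ [])) unpair₂T (k ∷ [])
                 | ⟦unpair₁T⟧ {A} k | ⟦unpair₂T⟧ {A} k | ⟦principalT⟧ (unpair₁ k)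
                 | graph-≡ᵇ principal k = refl

majorreducible⇒introreducible : ∀ {A} → Infinite A → Majorreducible A → Introreducible A
majorreducible⇒introreducible {A} A-infinite A-majorreducible C C-infinite C⊆A =
  ≤T-trans (A-majorreducible A.principal A.principal-isPrincipal C.principal pC-majorizes)
           C.graph-principal-≤T
  where
  module A = Principal A A-infinite
  module C = Principal C C-infinite
  pC-majorizes : Majorizes C.principal A.principal
  pC-majorizes = principal-minimal A.principal-isPrincipal C.principal-increasing
                                   (λ n → C⊆A _ (C.principal-∈ n))

-- Enumerating A from finite pieces of a graph

graphPointSearchT : Term ∅ 3
graphPointSearchT =
  lit 1 `∸ `app bitT (var (suc (suc zero)) ∷ `app pairT (column ∷ var zero ∷ []) ∷ [])
  where
  column : Term ∅ 3
  column = `app unpair₁T (var (suc zero) ∷ [])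

⟦graphPointSearchT⟧ : ∀ z k u →
  ⟦ graphPointSearchT ⟧ (z ∷ k ∷ u ∷ []) ≡ 1 ∸ indicator (bit u (pair (unpair₁ k) z))
⟦graphPointSearchT⟧ z k u
  rewrite ⟦unpair₁T⟧ {∅} k | ⟦pairT⟧ {∅} (unpair₁ k) z | ⟦bitT⟧ {∅} u (pair (unpair₁ k) z) = refl

membershipT : Term ∅ 2
membershipT = `app bitT (var (suc zero) ∷ var zero ∷ [])

-- On (k, u): search for a z with ⟨unpair₁ k , z⟩ ∈ D u, then answer whether k ∈ D u.
-- If D u ⊆ graph f, the search can only find z = f (unpair₁ k), and then D u agrees
-- with graph f on all of column unpair₁ k.
graphOracle : Prog 2
graphOracle = comp (proj zero) (compile membershipT ∷ mu (compile graphPointSearchT) ∷ [])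

bit-decides-graph : ∀ f {u x} k → D u ⊆ graph f → bit u (pair x (f x)) ≡ true → unpair₁ k ≡ x →
                    bit u k ≡ graph f k
bit-decides-graph f {u} k D⊆G point refl = ≡true-ext (D⊆G k) in-D
  where
  in-D : graph f k ≡ true → bit u k ≡ true
  in-D k∈G = subst (λ j → bit u j ≡ true)
                   (trans (cong (pair (unpair₁ k)) (graph-sound f k k∈G)) (pair-unpair k)) point

graphOracle-sound : ∀ f {u} → D u ⊆ graph f → SoundOracle (graph f) ∅ graphOracle u
graphOracle-sound f {u} D⊆G k v
  (e-comp (ev-∷ member (ev-∷ (e-mu {n = z} found _) ev-[])) (e-proj zero)) = begin
  v                          ≡⟨ eval-deterministic member (compile-correct membershipT (k ∷ u ∷ [])) ⟩
  ⟦ membershipT ⟧ (k ∷ u ∷ []) ≡⟨ ⟦bitT⟧ {∅} u k ⟩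
  indicator (bit u k)        ≡⟨ cong indicator (bit-decides-graph f k D⊆G point refl) ⟩
  χ (graph f) k              ∎
  where
  open ≡-Reasoning
  x : ℕ
  x = unpair₁ k
  z-in-D : bit u (pair x z) ≡ true
  z-in-D = 1∸indicator≡0⇒true (trans (sym (⟦graphPointSearchT⟧ z k u))
             (eval-deterministic (compile-correct graphPointSearchT (z ∷ k ∷ u ∷ [])) found))
  fx≡z : f x ≡ z
  fx≡z = subst₂ (λ a b → f a ≡ b) (unpair₁-pair x z) (unpair₂-pair x z)
                (graph-sound f (pair x z) (D⊆G (pair x z) z-in-D))
  point : bit u (pair x (f x)) ≡ true
  point = subst (λ w → bit u (pair x w) ≡ true) (sym fx≡z) z-in-D

graphOracle-complete : ∀ f {u} k → D u ⊆ graph f →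
                       bit u (pair (unpair₁ k) (f (unpair₁ k))) ≡ true →
                       Eval ∅ graphOracle (k ∷ u ∷ []) (χ (graph f) k)
graphOracle-complete f {u} k D⊆G point
  with least-zero (λ z → ⟦ graphPointSearchT ⟧ (z ∷ k ∷ u ∷ [])) (f (unpair₁ k))
                  (trans (⟦graphPointSearchT⟧ _ k u) (cong (λ b → 1 ∸ indicator b) point))
... | _ , least = subst (Eval ∅ graphOracle (k ∷ u ∷ [])) (graphOracle-sound f D⊆G k _ run) run
  where
  run : Eval ∅ graphOracle (k ∷ u ∷ []) (⟦ membershipT ⟧ (k ∷ u ∷ []))
  run = e-comp (ev-∷ (compile-correct membershipT (k ∷ u ∷ []))
                     (ev-∷ (mu-correct graphPointSearchT (k ∷ u ∷ []) least) ev-[]))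
               (e-proj zero)

graphCode : (ℕ → ℕ) → ℕ → ℕ
graphCode f zero = 0
graphCode f (suc N) = insert (graphCode f N) (pair N (f N))

D-graphCode⊆graph : ∀ f N → D (graphCode f N) ⊆ graph f
D-graphCode⊆graph f zero j j∈D =
  ⊥-elim (0≢1+n (cong indicator (trans (sym (bit-large 0 j z≤n)) j∈D)))
D-graphCode⊆graph f (suc N) j j∈D
  with ∨≡true⁻ (bit (graphCode f N) j)
                (trans (sym (bit-insert (graphCode f N) (pair N (f N)) j)) j∈D)
... | inj₁ j∈old = D-graphCode⊆graph f N j j∈old
... | inj₂ j≡new = subst (λ i → graph f i ≡ true) (sym (≡ᵇ-true⇒≡ {j} j≡new)) (graph-complete f N)

graphCode-∋ : ∀ f N x → x < N → bit (graphCode f N) (pair x (f x)) ≡ true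
graphCode-∋ f (suc N) x x<1+N rewrite bit-insert (graphCode f N) (pair N (f N)) (pair x (f x))
  with m<1+n⇒m<n∨m≡n x<1+N
... | inj₁ x<N rewrite graphCode-∋ f N x x<N = refl
... | inj₂ refl rewrite ≡⇒≡ᵇ-true {pair x (f x)} refl = ∨-zeroʳ _

haltIfPositive : Prog 1
haltIfPositive = mu (compile {∅} (lit 1 `∸ var (suc zero)))

haltIfPositive-halts : ∀ w → Eval ∅ haltIfPositive (suc w ∷ []) 0
haltIfPositive-halts w = mu-correct (lit 1 `∸ var (suc zero)) (suc w ∷ []) (0∸n≡0 w , λ _ ())

haltIfPositive-diverges : ∀ {y} → ¬ Eval ∅ haltIfPositive (0 ∷ []) y
haltIfPositive-diverges {y} (e-mu found _) =
  0≢1+n (eval-deterministic found (compile-correct {∅} (lit 1 `∸ var (suc zero)) (y ∷ 0 ∷ [])))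

-- The operator accepts ⟨u , n⟩ when P, with its queries answered from D u, gives a
-- positive output on n; by the use principle a finite piece of graph f suffices.
≤T-graph⇒≤e-graph : ∀ {A} f → A ≤T graph f → A ≤e graph f
≤T-graph⇒≤e-graph {A} f (P , P-computes) = enumerator , λ n → mk⇔ (enumerated n) (enumerated⇒∈ n)
  where
  G : SetN
  G = graph f
  decoder : Vec (Prog 1) 2
  decoder = compile (unpair₂T {∅}) ∷ compile (unpair₁T {∅}) ∷ []
  enumerator : Prog 1
  enumerator = comp haltIfPositive (comp (relativize graphOracle P) decoder ∷ [])

  decoder-correct : ∀ u n → EvalVec ∅ decoder (pair u n ∷ []) (n ∷ u ∷ [])
  decoder-correct u n =
    ev-∷ (compile-correct′ unpair₂T (trans (⟦unpair₂T⟧ {∅} (pair u n)) (unpair₂-pair u n)))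
    (ev-∷ (compile-correct′ unpair₁T (trans (⟦unpair₁T⟧ {∅} (pair u n)) (unpair₁-pair u n))) ev-[])

  enumerated : ∀ n → A n ≡ true → ∃ λ u → D u ⊆ G × InW enumerator (pair u n)
  enumerated n n∈A with N , run ← relativize-complete {Y = ∅} {O = graphOracle} (P-computes n) =
    u , D-graphCode⊆graph f (suc N) ,
    0 , e-comp (ev-∷ (e-comp (decoder-correct u n) (run ≤-refl u oracle)) ev-[]) halts
    where
    u : ℕ
    u = graphCode f (suc N)
    oracle : OracleUpTo G ∅ graphOracle u N
    oracle k k≤N = graphOracle-complete f k (D-graphCode⊆graph f (suc N))
                     (graphCode-∋ f (suc N) (unpair₁ k) (s≤s (≤-trans (unpair₁≤ k) k≤N)))
    halts : Eval ∅ haltIfPositive (χ A n ∷ []) 0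
    halts rewrite n∈A = haltIfPositive-halts 0

  enumerated⇒∈ : ∀ n → (∃ λ u → D u ⊆ G × InW enumerator (pair u n)) → A n ≡ true
  enumerated⇒∈ n (u , D⊆G , _ , e-comp (ev-∷ (e-comp decoded run) ev-[]) halts)
    with refl ← evalVec-deterministic decoded (decoder-correct u n) =
    positive (eval-deterministic (P-computes n) (relativize-sound P (graphOracle-sound f D⊆G) run)) halts
    where
    positive : ∀ {w y} → χ A n ≡ w → Eval ∅ haltIfPositive (w ∷ []) y → A n ≡ true
    positive {w} χ≡w halts with A n
    ... | true = refl
    ... | false with refl ← χ≡w = ⊥-elim (haltIfPositive-diverges halts)

majorreducible⇒majorenumerable : ∀ {A} → Majorreducible A → Majorenumerable A
majorreducible⇒majorenumerable A-majorreducible p p-principal f f-majorizes =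
  ≤T-graph⇒≤e-graph f (A-majorreducible p p-principal f f-majorizes)

-- Step-bounded evaluation

allPositive : Vec ℕ m → ℕ
allPositive [] = 1
allPositive (z ∷ zs) = ifZero z 0 (allPositive zs)

-- A search through the candidates i < t, where c i is the clocked value of the test at i
-- (so 1 accepts i and suc (suc v) rejects it). The state is 0 while every candidate so far
-- is rejected, 1 once a test has not halted within the clock, and suc (suc j) once j is
-- accepted.
searchStep : ℕ → ℕ → ℕ
searchStep v i = ifZero v 1 (ifZero (v ∸ 1) (suc (suc i)) 0)

search : (ℕ → ℕ) → ℕ → ℕ
search c = recℕ 0 (λ i r → ifZero r (searchStep (c i) i) r)

-- clocked P t xs is suc y if P halts on xs with output y when every unbounded search
-- may only try candidates below t, and 0 otherwise.
mutual
  clocked : Prog k → ℕ → Vec ℕ k → ℕ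
  clocked zer t xs = 1
  clocked succ t (x ∷ []) = suc (suc x)
  clocked (proj i) t xs = suc (lookup xs i)
  clocked orc t xs = 1
  clocked (comp g hs) t xs =
    ifZero (allPositive (clocked* hs t xs)) 0 (clocked g t (map (_∸ 1) (clocked* hs t xs)))
  clocked (prec g s) t (n ∷ xs) =
    recℕ (clocked g t xs) (λ i r → ifZero r 0 (clocked s t (i ∷ (r ∸ 1) ∷ xs))) n
  clocked (mu f) t xs = search (λ i → clocked f t (i ∷ xs)) t ∸ 1

  clocked* : Vec (Prog k) m → ℕ → Vec ℕ k → Vec ℕ m
  clocked* [] t xs = []
  clocked* (h ∷ hs) t xs = clocked h t xs ∷ clocked* hs t xs

RejectedBelow : (ℕ → ℕ) → ℕ → Set
RejectedBelow c j = ∀ l → l < j → ∃ λ v → c l ≡ suc (suc v)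

rejectedBelow-suc : ∀ {c i v} → RejectedBelow c i → c i ≡ suc (suc v) → RejectedBelow c (suc i)
rejectedBelow-suc {v = v} running ci l l<1+i with m<1+n⇒m<n∨m≡n l<1+i
... | inj₁ l<i = running l l<i
... | inj₂ refl = v , ci

search-zero : ∀ c i → search c i ≡ 0 → RejectedBelow c i
search-zero c zero _ = λ _ ()
search-zero c (suc i) s≡0 with search c i in si | c i in ci
... | zero | suc (suc v) = rejectedBelow-suc (search-zero c i si) ci
... | zero | zero = ⊥-elim (0≢1+n (sym s≡0))
... | zero | suc zero = ⊥-elim (0≢1+n (sym s≡0))
... | suc _ | _ = ⊥-elim (0≢1+n (sym s≡0))

search-found : ∀ c i {j} → search c i ≡ suc (suc j) → c j ≡ 1 × RejectedBelow c j
search-found c zero ()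
search-found c (suc i) s≡j with search c i in si | c i in ci
... | suc _ | _ = search-found c i (trans si s≡j)
... | zero | suc zero with refl ← s≡j = ci , search-zero c i si
... | zero | suc (suc v) = ⊥-elim (0≢1+n s≡j)

search-rejecting : ∀ c {n} → RejectedBelow c n → ∀ i → i ≤ n → search c i ≡ 0
search-rejecting c running zero _ = refl
search-rejecting c running (suc i) 1+i≤n
  rewrite search-rejecting c running i (≤-trans (n≤1+n i) 1+i≤n)
  with _ , ci ← running i 1+i≤n rewrite ci = refl

search-finds : ∀ c {n} → c n ≡ 1 → RejectedBelow c n → ∀ t → n < t → search c t ≡ suc (suc n)
search-finds c {n} cn running (suc t) n<1+t with m<1+n⇒m<n∨m≡n n<1+t
... | inj₁ n<t rewrite search-finds c cn running t n<t = refl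
... | inj₂ refl rewrite search-rejecting c running n ≤-refl | cn = refl

allPositive≢0⇒ : (zs : Vec ℕ m) → allPositive zs ≢ 0 → zs ≡ map suc (map (_∸ 1) zs)
allPositive≢0⇒ [] _ = refl
allPositive≢0⇒ (zero ∷ zs) ≢0 = ⊥-elim (≢0 refl)
allPositive≢0⇒ (suc z ∷ zs) ≢0 = cong (suc z ∷_) (allPositive≢0⇒ zs ≢0)

allPositive-map-suc : (ys : Vec ℕ m) → allPositive (map suc ys) ≡ 1
allPositive-map-suc [] = refl
allPositive-map-suc (y ∷ ys) = allPositive-map-suc ys

map-∸1-map-suc : (ys : Vec ℕ m) → map (_∸ 1) (map suc ys) ≡ ys
map-∸1-map-suc ys = trans (sym (map-∘ (_∸ 1) suc ys)) (map-id ys)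

ifZero-0-suc⁻ : ∀ a {b y} → ifZero a 0 b ≡ suc y → a ≢ 0 × b ≡ suc y
ifZero-0-suc⁻ zero ()
ifZero-0-suc⁻ (suc a) b≡ = (λ ()) , b≡

∸1≡suc⁻ : ∀ {w y} → w ∸ 1 ≡ suc y → w ≡ suc (suc y)
∸1≡suc⁻ {zero} ()
∸1≡suc⁻ {suc w} eq = cong suc eq

mutual
  clocked-sound : (P : Prog k) (t : ℕ) (xs : Vec ℕ k) {y : ℕ} →
                  clocked P t xs ≡ suc y → Eval ∅ P xs y
  clocked-sound zer t xs refl = e-zer
  clocked-sound succ t (x ∷ []) refl = e-succ
  clocked-sound (proj i) t xs refl = e-proj i
  clocked-sound orc t (x ∷ []) refl = e-orc
  clocked-sound (comp g hs) t xs halts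
    with positive , g-halts ← ifZero-0-suc⁻ (allPositive (clocked* hs t xs)) halts =
    e-comp (clocked*-sound hs t xs (allPositive≢0⇒ (clocked* hs t xs) positive))
           (clocked-sound g t _ g-halts)
  clocked-sound (prec g s) t (n ∷ xs) halts = clocked-prec-sound g s t xs n halts
  clocked-sound (mu f) t xs halts
    with found , running ← search-found (λ i → clocked f t (i ∷ xs)) t (∸1≡suc⁻ halts) =
    e-mu (clocked-sound f t _ found)
         (λ l l<y → proj₁ (running l l<y) , clocked-sound f t _ (proj₂ (running l l<y)))

  clocked*-sound : (Ps : Vec (Prog k) m) (t : ℕ) (xs : Vec ℕ k) {ys : Vec ℕ m} →
                   clocked* Ps t xs ≡ map suc ys → EvalVec ∅ Ps xs ys
  clocked*-sound [] t xs {[]} _ = ev-[]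
  clocked*-sound (P ∷ Ps) t xs {y ∷ ys} halts with P-halts , Ps-halts ← ∷-injective halts =
    ev-∷ (clocked-sound P t xs P-halts) (clocked*-sound Ps t xs Ps-halts)

  clocked-prec-sound : (g : Prog k) (s : Prog (suc (suc k))) (t : ℕ) (xs : Vec ℕ k) (n : ℕ)
                       {y : ℕ} → clocked (prec g s) t (n ∷ xs) ≡ suc y → Eval ∅ (prec g s) (n ∷ xs) y
  clocked-prec-sound g s t xs zero halts = e-prec0 (clocked-sound g t xs halts)
  clocked-prec-sound g s t xs (suc n) halts with clocked (prec g s) t (n ∷ xs) in previous
  clocked-prec-sound g s t xs (suc n) () | zero
  clocked-prec-sound g s t xs (suc n) halts | suc r =
    e-precS (clocked-prec-sound g s t xs n previous) (clocked-sound s t _ halts)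

clocked-comp : (g : Prog m) (hs : Vec (Prog k) m) (t : ℕ) (xs : Vec ℕ k) {ys : Vec ℕ m} {y : ℕ} →
               clocked* hs t xs ≡ map suc ys → clocked g t ys ≡ suc y →
               clocked (comp g hs) t xs ≡ suc y
clocked-comp g hs t xs {ys} hs-halt g-halts
  rewrite hs-halt | allPositive-map-suc ys | map-∸1-map-suc ys = g-halts

clocked-precS : (g : Prog k) (s : Prog (suc (suc k))) (t : ℕ) (xs : Vec ℕ k) {n r y : ℕ} →
                clocked (prec g s) t (n ∷ xs) ≡ suc r → clocked s t (n ∷ r ∷ xs) ≡ suc y →
                clocked (prec g s) t (suc n ∷ xs) ≡ suc y
clocked-precS g s t xs previous s-halts rewrite previous = s-halts

mutual
  clocked-complete : {P : Prog k} {xs : Vec ℕ k} {y : ℕ} →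
                     Eval ∅ P xs y → Eventually (λ t → clocked P t xs ≡ suc y)
  clocked-complete e-zer = 0 , λ _ → refl
  clocked-complete e-succ = 0 , λ _ → refl
  clocked-complete (e-proj i) = 0 , λ _ → refl
  clocked-complete e-orc = 0 , λ _ → refl
  clocked-complete {P = comp g hs} {xs} (e-comp es e) =
    eventually-map (λ {t} (hs-halt , g-halts) → clocked-comp g hs t xs hs-halt g-halts)
      (eventually-× (clocked*-complete es) (clocked-complete e))
  clocked-complete (e-prec0 e) = clocked-complete e
  clocked-complete {P = prec g s} {_ ∷ xs} (e-precS e₁ e₂) =
    eventually-map (λ {t} (previous , s-halts) → clocked-precS g s t xs previous s-halts)
      (eventually-× (clocked-complete e₁) (clocked-complete e₂))
  clocked-complete {P = mu f} {xs} (e-mu {n = n} found below) =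
    eventually-map (λ {t} ((found′ , running) , n<t) →
                      cong (_∸ 1) (search-finds (λ i → clocked f t (i ∷ xs)) found′ running t n<t))
      (eventually-× (eventually-× (clocked-complete found) rejecting-eventually) (suc n , λ n<t → n<t))
    where
    rejecting-eventually : Eventually (λ t → RejectedBelow (λ i → clocked f t (i ∷ xs)) n)
    rejecting-eventually =
      eventually-∀< (λ l t → ∃ λ v → clocked f t (l ∷ xs) ≡ suc (suc v)) n
        (λ l l<n → eventually-map (λ halts → proj₁ (below l l<n) , halts)
                                  (clocked-complete (proj₂ (below l l<n))))

  clocked*-complete : {Ps : Vec (Prog k) m} {xs : Vec ℕ k} {ys : Vec ℕ m} →
                      EvalVec ∅ Ps xs ys → Eventually (λ t → clocked* Ps t xs ≡ map suc ys)
  clocked*-complete ev-[] = 0 , λ _ → refl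
  clocked*-complete (ev-∷ e es) =
    eventually-map (λ (halts , halt) → cong₂ _∷_ halts halt)
      (eventually-× (clocked-complete e) (clocked*-complete es))

vars : (Fin m → Fin k) → Vec (Term X k) m
vars f = tabulate (λ i → var (f i))

⟦vars⟧ : (f : Fin m → Fin k) (ys : Vec ℕ k) →
         ⟦ vars {X = X} f ⟧* ys ≡ tabulate (λ i → lookup ys (f i))
⟦vars⟧ {m = zero} f ys = refl
⟦vars⟧ {m = suc m} {X = X} f ys =
  cong (lookup ys (f zero) ∷_) (⟦vars⟧ {X = X} (λ i → f (suc i)) ys)

dropVars : ∀ j → Vec (Term X (j + k)) k
dropVars j = vars (j ↑ʳ_)

⟦dropVars⟧ : ∀ {j} (zs : Vec ℕ j) (xs : Vec ℕ k) → ⟦ dropVars {X = X} j ⟧* (zs ++ xs) ≡ xs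
⟦dropVars⟧ {X = X} {j} zs xs =
  trans (⟦vars⟧ {X = X} (j ↑ʳ_) (zs ++ xs))
        (trans (tabulate-cong (lookup-++ʳ zs xs)) (tabulate∘lookup xs))

allPositiveT : Vec (Term X k) m → Term X k
allPositiveT [] = lit 1
allPositiveT (t ∷ ts) = `ifz t (lit 0) (allPositiveT ts)

⟦allPositiveT⟧ : (ts : Vec (Term X k) m) (xs : Vec ℕ k) →
                 ⟦ allPositiveT ts ⟧ xs ≡ allPositive (⟦ ts ⟧* xs)
⟦allPositiveT⟧ [] xs = refl
⟦allPositiveT⟧ (t ∷ ts) xs = cong (ifZero (⟦ t ⟧ xs) 0) (⟦allPositiveT⟧ ts xs)

predT* : Vec (Term X k) m → Vec (Term X k) m
predT* = map (_`∸ lit 1)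

⟦predT*⟧ : (ts : Vec (Term X k) m) (xs : Vec ℕ k) →
           ⟦ predT* ts ⟧* xs ≡ map (_∸ 1) (⟦ ts ⟧* xs)
⟦predT*⟧ [] xs = refl
⟦predT*⟧ (t ∷ ts) xs = cong (⟦ t ⟧ xs ∸ 1 ∷_) (⟦predT*⟧ ts xs)

searchStepT : Term X (suc k) → Term X (suc k)
searchStepT v = `ifz v (lit 1) (`ifz (v `∸ lit 1) (`suc (`suc (var zero))) (lit 0))

mutual
  clockedT : Prog k → Term X (suc k)
  clockedT zer = lit 1
  clockedT succ = `suc (`suc (var (suc zero)))
  clockedT (proj i) = `suc (var (suc i))
  clockedT orc = lit 1
  clockedT (comp g hs) =
    `ifz (allPositiveT (clockedT* hs)) (lit 0) (`app (clockedT g) (var zero ∷ predT* (clockedT* hs)))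
  clockedT (prec g s) =
    `rec (`app (clockedT g) (var zero ∷ dropVars 2))
         (`ifz (var (suc zero)) (lit 0)
               (`app (clockedT s) (var (suc (suc zero)) ∷ var zero ∷ (var (suc zero) `∸ lit 1)
                                   ∷ dropVars 4)))
         (var (suc zero))
  clockedT (mu f) =
    `rec (lit 0)
         (`ifz (var (suc zero))
               (searchStepT (`app (clockedT f) (var (suc (suc zero)) ∷ var zero ∷ dropVars 3)))
               (var (suc zero)))
         (var zero)
    `∸ lit 1

  clockedT* : Vec (Prog k) m → Vec (Term X (suc k)) m
  clockedT* [] = []
  clockedT* (h ∷ hs) = clockedT h ∷ clockedT* hs

mutual
  ⟦clockedT⟧ : (P : Prog k) (t : ℕ) (xs : Vec ℕ k) →
               ⟦ clockedT {X = X} P ⟧ (t ∷ xs) ≡ clocked P t xs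
  ⟦clockedT⟧ zer t xs = refl
  ⟦clockedT⟧ succ t (x ∷ []) = refl
  ⟦clockedT⟧ (proj i) t xs = refl
  ⟦clockedT⟧ orc t xs = refl
  ⟦clockedT⟧ {X = X} (comp g hs) t xs
    rewrite ⟦allPositiveT⟧ (clockedT* {X = X} hs) (t ∷ xs)
          | ⟦predT*⟧ (clockedT* {X = X} hs) (t ∷ xs)
          | ⟦clockedT*⟧ {X = X} hs t xs
          | ⟦clockedT⟧ {X = X} g t (map (_∸ 1) (clocked* hs t xs)) = refl
  ⟦clockedT⟧ {X = X} (prec g s) t (n ∷ xs) =
    recℕ-cong (trans (cong (λ ys → ⟦ clockedT {X = X} g ⟧ (t ∷ ys))
                           (⟦dropVars⟧ {X = X} (t ∷ n ∷ []) xs))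
                     (⟦clockedT⟧ g t xs))
              (λ i r → cong (ifZero r 0)
                 (trans (cong (λ ys → ⟦ clockedT {X = X} s ⟧ (t ∷ i ∷ (r ∸ 1) ∷ ys))
                              (⟦dropVars⟧ {X = X} (i ∷ r ∷ t ∷ n ∷ []) xs))
                        (⟦clockedT⟧ s t _)))
              n
  ⟦clockedT⟧ {X = X} (mu f) t xs =
    cong (_∸ 1) (recℕ-cong refl
      (λ i r → cong (λ v → ifZero r (searchStep v i) r)
         (trans (cong (λ ys → ⟦ clockedT {X = X} f ⟧ (t ∷ i ∷ ys))
                      (⟦dropVars⟧ {X = X} (i ∷ r ∷ t ∷ []) xs))
                (⟦clockedT⟧ f t (i ∷ xs))))
      t)

  ⟦clockedT*⟧ : (Ps : Vec (Prog k) m) (t : ℕ) (xs : Vec ℕ k) →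
                ⟦ clockedT* {X = X} Ps ⟧* (t ∷ xs) ≡ clocked* Ps t xs
  ⟦clockedT*⟧ [] t xs = refl
  ⟦clockedT*⟧ (P ∷ Ps) t xs = cong₂ _∷_ (⟦clockedT⟧ P t xs) (⟦clockedT*⟧ Ps t xs)

-- Infinite enumerable sets have infinite computable subsets

module LeastSearch {X : SetN} (t : Term X 2) (witness : ∀ s → ∃ λ w → ⟦ t ⟧ (w ∷ s ∷ []) ≡ 0)
  where

  least : ∀ s → ∃ (LeastZero (λ w → ⟦ t ⟧ (w ∷ s ∷ [])))
  least s = least-zero _ (proj₁ (witness s)) (proj₂ (witness s))

  μ : ℕ → ℕ
  μ s = proj₁ (least s)

  μ-computable : Computes X (mu (compile t)) μ
  μ-computable s = mu-correct t (s ∷ []) (proj₂ (least s))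

  μ-zero : ∀ s → ⟦ t ⟧ (μ s ∷ s ∷ []) ≡ 0
  μ-zero s = proj₁ (proj₂ (least s))

module Enumeration {A X : SetN} (A-infinite : Infinite A) (e : Prog 1)
  (e-enumerates : ∀ n → (A n ≡ true) ⇔ (∃ λ u → (D u ⊆ X) × InW e (pair u n))) where

  -- Zero exactly when ⟨u , ⟨m , t⟩⟩ shows that some m > s lies in A: D u ⊆ X, and e
  -- halts on ⟨u , m⟩ with every search limited to t candidates.
  witnessCheck : ℕ → ℕ → ℕ → ℕ → ℕ
  witnessCheck s u m t = (suc s ∸ m) + (misses X u u + ifZero (clocked e t (pair u m ∷ [])) 1 0)

  witnessT : Term X 2
  witnessT = (`suc (var (suc zero)) `∸ mT)
             `+ (`app missesT (uT ∷ [])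
                 `+ `ifz (`app (clockedT e) (tT ∷ `app pairT (uT ∷ mT ∷ []) ∷ [])) (lit 1) (lit 0))
    where
    uT mT tT : Term X 2
    uT = `app unpair₁T (var zero ∷ [])
    mT = `app unpair₁T (`app unpair₂T (var zero ∷ []) ∷ [])
    tT = `app unpair₂T (`app unpair₂T (var zero ∷ []) ∷ [])

  ⟦witnessT⟧ : ∀ w s → ⟦ witnessT ⟧ (w ∷ s ∷ []) ≡
                       witnessCheck s (unpair₁ w) (unpair₁ (unpair₂ w)) (unpair₂ (unpair₂ w))
  ⟦witnessT⟧ w s
    rewrite ⟦unpair₁T⟧ {X} w | ⟦unpair₂T⟧ {X} w
          | ⟦unpair₁T⟧ {X} (unpair₂ w) | ⟦unpair₂T⟧ {X} (unpair₂ w)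
          | ⟦missesT⟧ {X} (unpair₁ w) | ⟦pairT⟧ {X} (unpair₁ w) (unpair₁ (unpair₂ w))
          | ⟦clockedT⟧ {X = X} e (unpair₂ (unpair₂ w)) (pair (unpair₁ w) (unpair₁ (unpair₂ w)) ∷ [])
          = refl

  witnessCheck-sound : ∀ s u m t → witnessCheck s u m t ≡ 0 → s < m × A m ≡ true
  witnessCheck-sound s u m t check≡0 =
    m∸n≡0⇒m≤n 1+s∸m≡0 , Equivalence.from (e-enumerates m) (u , misses≡0⇒D⊆ u misses≡0 , halts)
    where
    1+s∸m≡0 : suc s ∸ m ≡ 0
    1+s∸m≡0 = m+n≡0⇒m≡0 (suc s ∸ m) check≡0
    rest≡0 : misses X u u + ifZero (clocked e t (pair u m ∷ [])) 1 0 ≡ 0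
    rest≡0 = m+n≡0⇒n≡0 (suc s ∸ m) check≡0
    misses≡0 : misses X u u ≡ 0
    misses≡0 = m+n≡0⇒m≡0 (misses X u u) rest≡0
    halts : InW e (pair u m)
    halts with clocked e t (pair u m ∷ []) in run | m+n≡0⇒n≡0 (misses X u u) rest≡0
    ... | zero | ()
    ... | suc y | _ = y , clocked-sound e t _ run

  ⟦witnessT⟧-pair : ∀ u m t s → ⟦ witnessT ⟧ (pair u (pair m t) ∷ s ∷ []) ≡ witnessCheck s u m t
  ⟦witnessT⟧-pair u m t s
    rewrite ⟦witnessT⟧ (pair u (pair m t)) s | unpair₁-pair u (pair m t) | unpair₂-pair u (pair m t)
          | unpair₁-pair m t | unpair₂-pair m t = refl

  witness : ∀ s → ∃ λ w → ⟦ witnessT ⟧ (w ∷ s ∷ []) ≡ 0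
  witness s
    with m , s<m , m∈A ← A-infinite (suc s)
    with u , D⊆X , y , run ← Equivalence.to (e-enumerates m) m∈A
    with t , halts ← clocked-complete run
    = pair u (pair m t) ,
      trans (⟦witnessT⟧-pair u m t s)
            (cong₂ _+_ (m≤n⇒m∸n≡0 s<m)
                       (cong₂ _+_ (D⊆⇒misses≡0 u u D⊆X) (cong (λ c → ifZero c 1 0) (halts ≤-refl))))

  open LeastSearch witnessT witness

  selectT : Term X 1
  selectT = `app unpair₁T (`app unpair₂T (`embed _ μ μ-computable (var zero) ∷ []) ∷ [])

  select : ℕ → ℕ
  select s = ⟦ selectT ⟧ (s ∷ [])

  select-spec : ∀ s → s < select s × A (select s) ≡ true
  select-spec s =
    subst (λ m → s < m × A m ≡ true) (sym select≡)
          (witnessCheck-sound s (unpair₁ (μ s)) (unpair₁ (unpair₂ (μ s))) (unpair₂ (unpair₂ (μ s)))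
            (trans (sym (⟦witnessT⟧ (μ s) s)) (μ-zero s)))
    where
    select≡ : select s ≡ unpair₁ (unpair₂ (μ s))
    select≡ = trans (cong (λ v → ⟦ unpair₁T {X} ⟧ (v ∷ [])) (⟦unpair₂T⟧ {X} (μ s)))
                    (⟦unpair₁T⟧ {X} (unpair₂ (μ s)))

anyBelow : (ℕ → Bool) → ℕ → Bool
anyBelow P zero = false
anyBelow P (suc n) = anyBelow P n ∨ P n

anyBelow-sound : ∀ P n → anyBelow P n ≡ true → ∃ λ s → P s ≡ true
anyBelow-sound P (suc n) any with ∨≡true⁻ (anyBelow P n) any
... | inj₁ below = anyBelow-sound P n below
... | inj₂ at-n = n , at-n

anyBelow-complete : ∀ P {n s} → s < n → P s ≡ true → anyBelow P n ≡ true
anyBelow-complete P {suc n} s<1+n Ps with m<1+n⇒m<n∨m≡n s<1+n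
... | inj₁ s<n rewrite anyBelow-complete P s<n Ps = refl
... | inj₂ refl rewrite Ps = ∨-zeroʳ _

-- Searching s ≤ m is enough for every h with n ≤ h n, in particular increasing ones.
Range : (ℕ → ℕ) → SetN
Range h m = anyBelow (λ s → h s ≡ᵇ m) (suc m)

range-sound : ∀ h m → Range h m ≡ true → ∃ λ s → h s ≡ m
range-sound h m m∈R with s , hs≡m ← anyBelow-sound _ (suc m) m∈R = s , ≡ᵇ-true⇒≡ hs≡m

range-complete : ∀ {h} → Increasing h → ∀ s → Range h (h s) ≡ true
range-complete {h} inc s = anyBelow-complete _ (s≤s (increasing⇒n≤ inc s)) (≡⇒≡ᵇ-true {h s} refl)

range-≤T : (hT : Term X 1) → Range (λ n → ⟦ hT ⟧ (n ∷ [])) ≤T X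
range-≤T {X} hT = term-≤T rangeT (λ m → go m (suc m))
  where
  h : ℕ → ℕ
  h n = ⟦ hT ⟧ (n ∷ [])
  hitT : Term X 3
  hitT = `app hT (var zero ∷ []) `≟ var (suc (suc zero))
  rangeT : Term X 1
  rangeT = `rec (lit 0) (`ifz (var (suc zero)) hitT (lit 1)) (`suc (var zero))
  step : ∀ b c → ifZero (indicator b) (indicator c) 1 ≡ indicator (b ∨ c)
  step false c = refl
  step true c = refl
  go : ∀ m n → recℕ 0 (λ i r → ifZero r (⟦ hitT ⟧ (i ∷ r ∷ m ∷ [])) 1) n
               ≡ indicator (anyBelow (λ s → h s ≡ᵇ m) n)
  go m zero = refl
  go m (suc n) rewrite go m n =
    trans (cong (λ b → ifZero (indicator below) b 1)
                (⟦≟⟧ (`app hT (var zero ∷ [])) (var (suc (suc zero))) (n ∷ indicator below ∷ m ∷ [])))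
          (step below (h n ≡ᵇ m))
    where
    below : Bool
    below = anyBelow (λ s → h s ≡ᵇ m) n

expanding-selector⇒infinite-computable-subset : ∀ {A} (gT : Term X 1) →
  (∀ s → s < ⟦ gT ⟧ (s ∷ []) × A (⟦ gT ⟧ (s ∷ [])) ≡ true) →
  ∃ λ C → Infinite C × C ⊆ A × C ≤T X
expanding-selector⇒infinite-computable-subset {X} {A} gT selects =
  Range iterates , infinite , subset , range-≤T iteratesT
  where
  iteratesT : Term X 1
  iteratesT = `rec (`app gT (lit 0 ∷ [])) (`app gT (var (suc zero) ∷ [])) (var zero)
  iterates : ℕ → ℕ
  iterates n = ⟦ iteratesT ⟧ (n ∷ [])
  iterates-increasing : Increasing iterates
  iterates-increasing n = proj₁ (selects (iterates n))
  iterates-∈ : ∀ n → A (iterates n) ≡ true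
  iterates-∈ zero = proj₂ (selects 0)
  iterates-∈ (suc n) = proj₂ (selects (iterates n))
  infinite : Infinite (Range iterates)
  infinite n = iterates n , increasing⇒n≤ iterates-increasing n , range-complete iterates-increasing n
  subset : Range iterates ⊆ A
  subset m m∈R with s , refl ← range-sound iterates m m∈R = iterates-∈ s

≤e⇒infinite-computable-subset : ∀ {A} → Infinite A → A ≤e X → ∃ λ C → Infinite C × C ⊆ A × C ≤T X
≤e⇒infinite-computable-subset A-infinite (e , e-enumerates) =
  expanding-selector⇒infinite-computable-subset selectT select-spec
  where open Enumeration A-infinite e e-enumerates

majorenumerable∧introreducible⇒majorreducible : ∀ {A} → Infinite A →
  Majorenumerable A → Introreducible A → Majorreducible A
majorenumerable∧introreducible⇒majorreducible {A} A-infinite A-majorenumerable A-introreducible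
                                               p p-principal f f-majorizes =
  via-subset (≤e⇒infinite-computable-subset A-infinite (A-majorenumerable p p-principal f f-majorizes))
  where
  via-subset : (∃ λ C → Infinite C × C ⊆ A × C ≤T graph f) → A ≤T graph f
  via-subset (C , C-infinite , C⊆A , C≤Tgraph) = ≤T-trans (A-introreducible C C-infinite C⊆A) C≤Tgraph

theorem5p3 : (A : SetN) → Infinite A →
    Majorreducible A ⇔ (Majorenumerable A × Introreducible A)
theorem5p3 A A-infinite = mk⇔
  (λ A-majorreducible → majorreducible⇒majorenumerable A-majorreducible ,
                        majorreducible⇒introreducible A-infinite A-majorreducible)
  (λ (A-majorenumerable , A-introreducible) →
     majorenumerable∧introreducible⇒majorreducible A-infinite A-majorenumerable A-introreducible)
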